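{- Let $G=(P,E)$ be a finite graph with a legal coloring $col:P\to\{1,2,3,\dots\}$ (adjacent nodes receive different colors). For each holiday $i=1,2,3,\dots$, declare a node $p$ with color $c=col(p)$ happy at holiday $i$ if and only if the $|\omega(c)|$ least significant bits of the binary representation of $i$ (padded with leading zeros if necessary), read from most to least significant, equal the reversal $\omega(c)^R$ of the Elias omega code $\omega(c)$ of $c$. Then for every node $p$ with color $c$, in every sequence of $\phi(c)\cdot 2^{\log^* c+1}$ consecutive holidays, $p$ is happy at least once.
   Context: Logarithms are base 2. For a positive integer $n$, $B(n)$ is the binary representation of $n$ without leading zeros. The Elias omega code is defined by: $re(1)=\lambda$ (the empty string) and, for $i>1$, $re(i)=re(|B(i)|-1)\circ B(i)$ where $\circ$ is concatenation and $|B(i)|$ is the number of bits of $B(i)$; then $\omega(i)=re(i)\circ 0$. For a string $S$, $S^R$ is $S$ reversed. The function $\phi$ is defined on reals by $\phi(x)=1$ if $x\le 1$ and $\phi(x)=x\cdot\phi(\log x)$ if $x>1$ (so $\phi(c)=c\cdot\log c\cdot\log\log c\cdots$). $\log^* c$ is the least $k\ge 0$ such that the $k$-fold iterated logarithm of $c$ is at most $1$. -}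

module Defs where

open import Data.Nat using (ℕ; zero; suc; _+_; _*_; _∸_; _^_; _≤_; _<_; _/_; _%_; _≡ᵇ_; _≤ᵇ_)
open import Data.Bool using (Bool; true; false; if_then_else_)
open import Data.List using (List; []; _∷_; _++_; [_]; length; reverse)
open import Data.Fin using (Fin; toℕ)
open import Data.Product using (Σ; ∃; _×_; _,_)

-- binAux f n : binary representation of n, most significant bit first,
-- no leading zeros (empty for n = 0).  The fuel f ≥ n always suffices.
binAux : ℕ → ℕ → List Bool
binAux zero    _       = []
binAux (suc f) zero    = []
binAux (suc f) (suc m) = binAux f (suc m / 2) ++ [ (suc m % 2) ≡ᵇ 1 ]

B : ℕ → List Bool
B n = binAux n n

-- re with fuel (fuel n suffices since |B(n)|-1 < n for n ≥ 2)
reAux : ℕ → ℕ → List Bool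
reAux zero    _ = []
reAux (suc f) i = if i ≤ᵇ 1 then [] else (reAux f (length (B i) ∸ 1) ++ B i)

re : ℕ → List Bool
re i = reAux i i

ω : ℕ → List Bool
ω i = re i ++ [ false ]

lowBits : ℕ → ℕ → List Bool
lowBits zero    i = []
lowBits (suc t) i = lowBits t (i / 2) ++ [ (i % 2) ≡ᵇ 1 ]

Happy : ℕ → ℕ → Set
Happy c i = lowBits (length (ω c)) i ≡ reverse (ω c)
  where open import Relation.Binary.PropositionalEquality using (_≡_)

-- log* : log^k c ≤ 1  iff  c ≤ tower k  (for c ≥ 1)

tower : ℕ → ℕ
tower zero    = 1
tower (suc k) = 2 ^ tower k

IsLogStar : ℕ → ℕ → Set
IsLogStar c k = (c ≤ tower k) × (∀ j → j < k → tower j < c)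

-- Exact comparison with the real number φ(c) · M, via rational
-- approximations from below (a rational a/b is a pair of naturals, b > 0).

-- BelowLog c j a b  :⇔  a/b < log^j c   (real, iterated base-2 logarithm)
--   a/b < c                 ⇔ a < c·b
--   a/b < log y             ⇔ ∃ rational u/v with 2^(a/b) < u/v < y
--   2^(a/b) < u/v           ⇔ 2^a · v^b < u^b
BelowLog : ℕ → ℕ → ℕ → ℕ → Set
BelowLog c zero    a b = a < c * b
BelowLog c (suc j) a b =
  Σ ℕ λ u → Σ ℕ λ v → (0 < v) × BelowLog c j u v × (2 ^ a * v ^ b < u ^ b)

prodF : {k : ℕ} → (Fin k → ℕ) → ℕ
prodF {zero}  f = 1
prodF {suc k} f = f Fin.zero * prodF (λ j → f (Fin.suc j))
  where import Data.Fin as Fin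

-- With k = log* c we have φ(c) = ∏_{j<k} log^j c, each factor > 1.
-- PhiTimesLe c k M L  :⇔  φ(c) · M ≤ L, expressed as: every product of
-- nonnegative rational lower approximations a_j/b_j < log^j c (j < k),
-- times M, is ≤ L.
PhiTimesLe : ℕ → ℕ → ℕ → ℕ → Set
PhiTimesLe c k M L =
  (a b : Fin k → ℕ) →
  (∀ j → (0 < b j) × BelowLog c (toℕ j) (a j) (b j)) →
  M * prodF a ≤ L * prodF b

{-# OPTIONS --safe #-}
-- Happiness at holiday i depends only on i mod 2^|ω(c)|, and every residue occurs in any
-- 2^|ω(c)| consecutive holidays, so it suffices that 2^|ω(c)| ≤ φ(c) · 2^(k+1) with k = log* c.
-- ω(c) consists of blocks B(⌊log^j c⌋), one for each j < k at most, and a final 0; a block B(x) of length ℓ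
-- has 2^ℓ ≤ 2x; hence 2^|ω(c)| ≤ 2^(k+1) ∏_{j<k} ⌊log^j c⌋.  The hypothesis on L only bounds
-- products of rationals below the real log^j c; taking rationals just below the integers
-- ⌊log^j c⌋, the Bernoulli-type bound (1 + 1/(w+k))^k ≤ 1 + k/w makes the error smaller than
-- what integrality of the product can absorb.
module Submission where

open import Defs
open import Data.Bool using (Bool; true; false)
open import Data.Fin using (Fin; toℕ)
import Data.Fin as Fin
open import Data.Fin.Properties using (toℕ<n)
open import Data.List using (List; []; _∷_; _++_; [_]; length; reverse)
open import Data.List.Properties using (length-++; unfold-reverse)
open import Data.Nat
open import Data.Nat.DivMod using (+-distrib-/-∣ʳ; m*n/n≡m; [m+kn]%n≡m%n; m/n*n≤m; m≥n⇒m/n>0; m/n<m; m≡m%n+[m/n]*n; m%n<n)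
open import Data.Nat.Divisibility using (divides-refl)
open import Data.Nat.Properties
open import Data.Nat.Tactic.RingSolver using (solve-∀)
open import Data.Product using (Σ; _×_; _,_)
open import Data.Sum using (inj₁; inj₂)
open import Relation.Binary.PropositionalEquality hiding ([_])

bit : Bool → ℕ
bit false = 0
bit true  = 1

lowBits-shift : ∀ t m q → lowBits (suc t) (m + q * 2) ≡ lowBits t (m / 2 + q) ++ [ m % 2 ≡ᵇ 1 ]
lowBits-shift t m q = cong₂ (λ n b → lowBits t n ++ [ b ≡ᵇ 1 ])
  (trans (+-distrib-/-∣ʳ m (divides-refl q)) (cong (m / 2 +_) (m*n/n≡m q 2)))
  ([m+kn]%n≡m%n m q 2)

lowBits-periodic : ∀ t i → lowBits t (i + 2 ^ t) ≡ lowBits t i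
lowBits-periodic zero    i = refl
lowBits-periodic (suc t) i = begin
  lowBits (suc t) (i + 2 ^ suc t)                   ≡⟨ cong (λ n → lowBits (suc t) (i + n)) (*-comm 2 (2 ^ t)) ⟩
  lowBits (suc t) (i + 2 ^ t * 2)                   ≡⟨ lowBits-shift t i (2 ^ t) ⟩
  lowBits t (i / 2 + 2 ^ t) ++ [ i % 2 ≡ᵇ 1 ]       ≡⟨ cong (_++ [ i % 2 ≡ᵇ 1 ]) (lowBits-periodic t (i / 2)) ⟩
  lowBits (suc t) i                                 ∎
  where open ≡-Reasoning

lowBits-bit : ∀ t b r → lowBits (suc t) (bit b + r * 2) ≡ lowBits t r ++ [ b ]
lowBits-bit t false r = lowBits-shift t 0 r
lowBits-bit t true  r = lowBits-shift t 1 r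

bit+r*2<2^suc : ∀ b {r t} → r < 2 ^ t → bit b + r * 2 < 2 ^ suc t
bit+r*2<2^suc b {r} {t} r<2^t = begin-strict
  bit b + r * 2  <⟨ +-monoˡ-< (r * 2) (bit<2 b) ⟩
  suc r * 2      ≤⟨ *-monoˡ-≤ 2 r<2^t ⟩
  2 ^ t * 2      ≡⟨ *-comm (2 ^ t) 2 ⟩
  2 ^ suc t      ∎
  where
  open ≤-Reasoning
  bit<2 : ∀ b → bit b < 2
  bit<2 false = z<s
  bit<2 true  = s<s z<s

lowBits-surjective : ∀ bs → Σ ℕ λ r → r < 2 ^ length bs × lowBits (length bs) r ≡ reverse bs
lowBits-surjective []       = 0 , z<s , refl
lowBits-surjective (b ∷ bs) with lowBits-surjective bs
... | r , r<2^t , hit = bit b + r * 2 , bit+r*2<2^suc b {t = length bs} r<2^t , (begin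
  lowBits (suc (length bs)) (bit b + r * 2)  ≡⟨ lowBits-bit (length bs) b r ⟩
  lowBits (length bs) r ++ [ b ]             ≡⟨ cong (_++ [ b ]) hit ⟩
  reverse bs ++ [ b ]                        ≡⟨ unfold-reverse b bs ⟨
  reverse (b ∷ bs)                           ∎)
  where open ≡-Reasoning

periodic-window : (P : ℕ → Set) {m r : ℕ} → (∀ i → P i → P (i + m)) → r < m → P r →
  ∀ s → Σ ℕ λ i → s ≤ i × i < s + m × P i
periodic-window P shift r<m Pr zero = _ , z≤n , r<m , Pr
periodic-window P shift r<m Pr (suc s) with periodic-window P shift r<m Pr s
... | i , s≤i , i<s+m , Pi with m≤n⇒m<n∨m≡n s≤i
...   | inj₁ s<i  = i , s<i , m<n⇒m<1+n i<s+m , Pi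
...   | inj₂ refl = i + _ , m<m+n i (m<n⇒0<n r<m) , ≤-refl , shift i Pi

2^len-++ : ∀ {A : Set} (xs ys : List A) → 2 ^ length (xs ++ ys) ≡ 2 ^ length xs * 2 ^ length ys
2^len-++ xs ys = trans (cong (2 ^_) (length-++ xs)) (^-distribˡ-+-* 2 (length xs) (length ys))

2^len-binAux≤2*n : ∀ f n → 1 ≤ n → 2 ^ length (binAux f n) ≤ 2 * n
2^len-binAux≤2*n zero          n       1≤n = ≤-trans 1≤n (m≤n*m n 2)
2^len-binAux≤2*n (suc zero)    (suc m) _   = *-monoʳ-≤ 2 (s≤s z≤n)
2^len-binAux≤2*n (suc (suc f)) 1       _   = ≤-refl
2^len-binAux≤2*n (suc f) n@(suc (suc m)) _ = begin
  2 ^ length (binAux f (n / 2) ++ [ _ ])  ≡⟨ 2^len-++ (binAux f (n / 2)) [ _ ] ⟩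
  2 ^ length (binAux f (n / 2)) * 2       ≤⟨ *-monoˡ-≤ 2 (2^len-binAux≤2*n f (n / 2) (m≥n⇒m/n>0 {n} (s≤s (s≤s z≤n)))) ⟩
  2 * (n / 2) * 2                         ≤⟨ *-monoˡ-≤ 2 (≤-trans (≤-reflexive (*-comm 2 (n / 2))) (m/n*n≤m n 2)) ⟩
  n * 2                                   ≡⟨ *-comm n 2 ⟩
  2 * n                                   ∎
  where open ≤-Reasoning

n<2^len-binAux : ∀ f n → n ≤ f → n < 2 ^ length (binAux f n)
n<2^len-binAux f       zero    _   = m^n>0 2 (length (binAux f 0))
n<2^len-binAux (suc f) n@(suc _) n≤1+f = begin-strict
  n                                 ≡⟨ m≡m%n+[m/n]*n n 2 ⟩
  n % 2 + n / 2 * 2                 <⟨ +-monoˡ-< (n / 2 * 2) (m%n<n n 2) ⟩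
  suc (n / 2) * 2                   ≤⟨ *-monoˡ-≤ 2 (n<2^len-binAux f (n / 2) half≤f) ⟩
  2 ^ length (binAux f (n / 2)) * 2 ≡⟨ 2^len-++ (binAux f (n / 2)) [ _ ] ⟨
  2 ^ length (binAux f (n / 2) ++ [ _ ]) ∎
  where
  open ≤-Reasoning
  half≤f : n / 2 ≤ f
  half≤f = ≤-pred (≤-trans (m/n<m n 2 (s≤s (s≤s z≤n))) n≤1+f)

2^m≤2^n⇒m≤n : ∀ {m n} → 2 ^ m ≤ 2 ^ n → m ≤ n
2^m≤2^n⇒m≤n le = ≮⇒≥ (λ n<m → <⇒≱ (^-monoʳ-< 2 (s≤s (s≤s z≤n)) n<m) le)

2^m<2^n⇒m<n : ∀ {m n} → 2 ^ m < 2 ^ n → m < n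
2^m<2^n⇒m<n lt = ≰⇒> (λ n≤m → <⇒≱ lt (^-monoʳ-≤ 2 n≤m))

⌊log⌋ : ℕ → ℕ
⌊log⌋ n = length (B n) ∸ 1

2^⌊log⌋n≤n : ∀ n → 1 ≤ n → 2 ^ ⌊log⌋ n ≤ n
2^⌊log⌋n≤n n 1≤n with length (B n) | 2^len-binAux≤2*n n n 1≤n
... | zero  | _      = 1≤n
... | suc ℓ | 2^ℓ≤2n = *-cancelˡ-≤ 2 2^ℓ≤2n

n≤2^T⇒⌊log⌋n≤T : ∀ {n T} → n ≤ 2 ^ T → ⌊log⌋ n ≤ T
n≤2^T⇒⌊log⌋n≤T {zero}      _    = z≤n
n≤2^T⇒⌊log⌋n≤T {n@(suc _)} {T} n≤2^T =
  ∸-monoˡ-≤ 1 (2^m≤2^n⇒m≤n {length (B n)} {suc T} (≤-trans (2^len-binAux≤2*n n n z<s) (*-monoʳ-≤ 2 n≤2^T)))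

2^T≤n⇒T≤⌊log⌋n : ∀ {n T} → 2 ^ T ≤ n → T ≤ ⌊log⌋ n
2^T≤n⇒T≤⌊log⌋n {n} {T} 2^T≤n = <⇒≤pred (2^m<2^n⇒m<n {T} {length (B n)} (≤-<-trans 2^T≤n (n<2^len-binAux n n ≤-refl)))

-- iterLog j c = ⌊log^j c⌋, because ⌊log ⌊x⌋⌋ = ⌊log x⌋.
iterLog : ℕ → ℕ → ℕ
iterLog zero    n = n
iterLog (suc j) n = iterLog j (⌊log⌋ n)

iterLog-suc : ∀ j n → iterLog (suc j) n ≡ ⌊log⌋ (iterLog j n)
iterLog-suc zero    n = refl
iterLog-suc (suc j) n = iterLog-suc j (⌊log⌋ n)

≤tower⇒iterLog≤1 : ∀ k {c} → c ≤ tower k → iterLog k c ≤ 1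
≤tower⇒iterLog≤1 zero    c≤1     = c≤1
≤tower⇒iterLog≤1 (suc k) c≤tower = ≤tower⇒iterLog≤1 k (n≤2^T⇒⌊log⌋n≤T c≤tower)

tower≤⇒1≤iterLog : ∀ j {c} → tower j ≤ c → 1 ≤ iterLog j c
tower≤⇒1≤iterLog zero    1≤c     = 1≤c
tower≤⇒1≤iterLog (suc j) tower≤c = tower≤⇒1≤iterLog j (2^T≤n⇒T≤⌊log⌋n tower≤c)

logStar⇒1≤iterLog : ∀ {c k} → IsLogStar c k → ∀ (j : Fin k) → 1 ≤ iterLog (toℕ j) c
logStar⇒1≤iterLog (_ , below) j = tower≤⇒1≤iterLog (toℕ j) (<⇒≤ (below (toℕ j) (toℕ<n j)))

floorPhi : ℕ → ℕ → ℕ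
floorPhi k c = prodF {k} (λ j → iterLog (toℕ j) c)

prodF-mono-≤ : ∀ {k} {f g : Fin k → ℕ} → (∀ j → f j ≤ g j) → prodF f ≤ prodF g
prodF-mono-≤ {zero}  _   = ≤-refl
prodF-mono-≤ {suc k} f≤g = *-mono-≤ (f≤g Fin.zero) (prodF-mono-≤ (λ j → f≤g (Fin.suc j)))

prodF-const : ∀ k n → prodF {k} (λ _ → n) ≡ n ^ k
prodF-const zero    n = refl
prodF-const (suc k) n = cong (n *_) (prodF-const k n)

prodF-*ʳ : ∀ {k} (f : Fin k → ℕ) n → prodF f * n ^ k ≡ prodF (λ j → f j * n)
prodF-*ʳ {zero}  f n = refl
prodF-*ʳ {suc k} f n = begin
  f Fin.zero * P * (n * n ^ k)   ≡⟨ regroup (f Fin.zero) P n (n ^ k) ⟩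
  f Fin.zero * n * (P * n ^ k)   ≡⟨ cong (f Fin.zero * n *_) (prodF-*ʳ (λ j → f (Fin.suc j)) n) ⟩
  prodF (λ j → f j * n)          ∎
  where
  open ≡-Reasoning
  P = prodF (λ j → f (Fin.suc j))
  regroup : ∀ a p n m → a * p * (n * m) ≡ a * n * (p * m)
  regroup = solve-∀

1≤prodF : ∀ {k} {f : Fin k → ℕ} → (∀ j → 1 ≤ f j) → 1 ≤ prodF f
1≤prodF {k} {f} 1≤f = subst (_≤ prodF f) (trans (prodF-const k 1) (^-zeroˡ k)) (prodF-mono-≤ 1≤f)

1≤2^k*floorPhi : ∀ k {i} → (∀ (j : Fin k) → 1 ≤ iterLog (toℕ j) i) → 1 ≤ 2 ^ k * floorPhi k i
1≤2^k*floorPhi k pos = *-mono-≤ (m^n>0 2 k) (1≤prodF pos)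

2^len-reAux≤ : ∀ k f i → iterLog k i ≤ 1 → (∀ (j : Fin k) → 1 ≤ iterLog (toℕ j) i) →
  2 ^ length (reAux f i) ≤ 2 ^ k * floorPhi k i
2^len-reAux≤ k       zero    i               _     pos = 1≤2^k*floorPhi k pos
2^len-reAux≤ k       (suc f) 0               _     pos = 1≤2^k*floorPhi k pos
2^len-reAux≤ k       (suc f) 1               _     pos = 1≤2^k*floorPhi k pos
2^len-reAux≤ zero    (suc f) (suc (suc i))   (s≤s ()) _
2^len-reAux≤ (suc k) (suc f) n@(suc (suc _)) top   pos = begin
  2 ^ length (reAux f (⌊log⌋ n) ++ B n)              ≡⟨ 2^len-++ (reAux f (⌊log⌋ n)) (B n) ⟩
  2 ^ length (reAux f (⌊log⌋ n)) * 2 ^ length (B n)  ≤⟨ *-mono-≤ rest (2^len-binAux≤2*n n n z<s) ⟩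
  2 ^ k * P * (2 * n)                                ≡⟨ regroup (2 ^ k) P n ⟩
  2 ^ suc k * (n * P)                                ∎
  where
  open ≤-Reasoning
  P = floorPhi k (⌊log⌋ n)
  rest = 2^len-reAux≤ k f (⌊log⌋ n) top (λ j → pos (Fin.suc j))
  regroup : ∀ a p n → a * p * (2 * n) ≡ 2 * a * (n * p)
  regroup = solve-∀

2^len-ω≤ : ∀ {c k} → IsLogStar c k → 2 ^ length (ω c) ≤ 2 ^ (k + 1) * floorPhi k c
2^len-ω≤ {c} {k} logStar@(c≤tower , _) = begin
  2 ^ length (re c ++ [ false ])  ≡⟨ 2^len-++ (re c) [ false ] ⟩
  2 ^ length (re c) * 2           ≤⟨ *-monoˡ-≤ 2 (2^len-reAux≤ k c c (≤tower⇒iterLog≤1 k c≤tower) (logStar⇒1≤iterLog logStar)) ⟩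
  2 ^ k * P * 2                   ≡⟨ regroup (2 ^ k) P ⟩
  2 * 2 ^ k * P                   ≡⟨ cong (λ e → 2 ^ e * P) (+-comm 1 k) ⟩
  2 ^ (k + 1) * P                 ∎
  where
  open ≤-Reasoning
  P = floorPhi k c
  regroup : ∀ a p → a * p * 2 ≡ 2 * a * p
  regroup = solve-∀

^-distribʳ-* : ∀ m n o → (m * n) ^ o ≡ m ^ o * n ^ o
^-distribʳ-* m n zero    = refl
^-distribʳ-* m n (suc o) = trans (cong (m * n *_) (^-distribʳ-* m n o)) (regroup m n (m ^ o) (n ^ o))
  where
  regroup : ∀ m n p q → m * n * (p * q) ≡ m * p * (n * q)
  regroup = solve-∀

x*n≤x*[1+n]∸1 : ∀ {x} n → 1 ≤ x → x * n ≤ x * suc n ∸ 1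
x*n≤x*[1+n]∸1 {suc x} n _ = +-monoʳ-≤ n (*-monoʳ-≤ x (n≤1+n n))

bernoulli : ∀ n w → suc (w + n) ^ n * w ≤ (w + n) ^ suc n
bernoulli zero    w = ≤-reflexive (base w)
  where
  base : ∀ w → 1 * w ≡ (w + 0) * 1
  base = solve-∀
bernoulli (suc n) w rewrite +-suc w n = begin
  Y * Y ^ n * w         ≡⟨ reorder Y (Y ^ n) w ⟩
  Y ^ n * (Y * w)       ≤⟨ *-monoʳ-≤ (Y ^ n) Yw≤[1+w]Z ⟩
  Y ^ n * (suc w * Z)   ≡⟨ *-assoc (Y ^ n) (suc w) Z ⟨
  Y ^ n * suc w * Z     ≤⟨ *-monoˡ-≤ Z (bernoulli n (suc w)) ⟩
  Z ^ suc n * Z         ≡⟨ *-comm (Z ^ suc n) Z ⟩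
  Z * Z ^ suc n         ∎
  where
  open ≤-Reasoning
  Z = suc (w + n)
  Y = suc Z
  reorder : ∀ y p w → y * p * w ≡ p * (y * w)
  reorder = solve-∀
  Yw≤[1+w]Z : Y * w ≤ suc w * Z
  Yw≤[1+w]Z = +-mono-≤ (m≤n⇒m≤1+n (m≤m+n w n)) (≤-reflexive (*-comm Z w))

bernoulli-half : ∀ {b w} → b < w → suc (w + b) ^ b < 2 * (w + b) ^ b
bernoulli-half {b} {w} b<w = *-cancelʳ-< w (suc (w + b) ^ b) (2 * (w + b) ^ b) (begin-strict
  suc (w + b) ^ b * w    ≤⟨ bernoulli b w ⟩
  (w + b) * (w + b) ^ b  <⟨ *-monoˡ-< ((w + b) ^ b) {{m^n≢0 (w + b) b {{w+b≢0}}}} (+-monoʳ-< w b<w) ⟩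
  (w + w) * (w + b) ^ b  ≡⟨ regroup w ((w + b) ^ b) ⟩
  2 * (w + b) ^ b * w    ∎)
  where
  open ≤-Reasoning
  w+b≢0 : NonZero (w + b)
  w+b≢0 = >-nonZero (≤-trans (m<n⇒0<n b<w) (m≤m+n w b))
  regroup : ∀ w p → (w + w) * p ≡ 2 * p * w
  regroup = solve-∀

rational-between : ∀ {a b C D} → a < C * b → 2 ^ C ≤ D →
  Σ ℕ λ u → Σ ℕ λ v → 0 < v × u < D * v × 2 ^ a * v ^ b < u ^ b
rational-between {a} {b} {C} {D} a<Cb 2^C≤D = D * N ∸ 1 , N , z<s , u<DN , 2^a*N^b<u^b
  where
  open ≤-Reasoning
  w = suc b
  N = suc (w + b)
  1≤D : 1 ≤ D
  1≤D = ≤-trans (m^n>0 2 C) 2^C≤D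
  u<DN : D * N ∸ 1 < D * N
  u<DN = ∸-monoʳ-< z<s (*-mono-≤ 1≤D z<s)
  regroup : ∀ t x → t * (2 * x) ≡ 2 * t * x
  regroup = solve-∀
  2^a*N^b<u^b : 2 ^ a * N ^ b < (D * N ∸ 1) ^ b
  2^a*N^b<u^b = begin-strict
    2 ^ a * N ^ b              <⟨ *-monoʳ-< (2 ^ a) {{m^n≢0 2 a}} (bernoulli-half (n<1+n b)) ⟩
    2 ^ a * (2 * (w + b) ^ b)  ≡⟨ regroup (2 ^ a) ((w + b) ^ b) ⟩
    2 ^ suc a * (w + b) ^ b    ≤⟨ *-monoˡ-≤ ((w + b) ^ b) (^-monoʳ-≤ 2 a<Cb) ⟩
    2 ^ (C * b) * (w + b) ^ b  ≡⟨ cong (_* (w + b) ^ b) (^-*-assoc 2 C b) ⟨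
    (2 ^ C) ^ b * (w + b) ^ b  ≤⟨ *-monoˡ-≤ ((w + b) ^ b) (^-monoˡ-≤ b 2^C≤D) ⟩
    D ^ b * (w + b) ^ b        ≡⟨ ^-distribʳ-* D (w + b) b ⟨
    (D * (w + b)) ^ b          ≤⟨ ^-monoˡ-≤ b (x*n≤x*[1+n]∸1 (w + b) 1≤D) ⟩
    (D * N ∸ 1) ^ b            ∎

floor-below-log : ∀ c j {a b} → a < iterLog j c * b → BelowLog c j a b
floor-below-log c zero             a<cb = a<cb
floor-below-log c (suc j) {a} {b} a< =
  step (iterLog j c) (floor-below-log c j) (subst (λ x → a < x * b) (iterLog-suc j c) a<)
  where
  step : ∀ D → (∀ {u v} → u < D * v → BelowLog c j u v) → a < ⌊log⌋ D * b → BelowLog c (suc j) a b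
  step zero      _     ()
  step D@(suc _) below a<⌊log⌋D*b with rational-between {C = ⌊log⌋ D} a<⌊log⌋D*b (2^⌊log⌋n≤n D z<s)
  ... | u , v , v>0 , u<Dv , 2^a*v^b<u^b = u , v , v>0 , below u<Dv , 2^a*v^b<u^b

pow-ratio-≤-cancel : ∀ {k Q L w} → L * k < w → Q * (w + k) ^ k ≤ L * suc (w + k) ^ k → Q ≤ L
pow-ratio-≤-cancel {k} {Q} {L} {w} Lk<w hyp = ≤-pred (*-cancelʳ-< w Q (suc L) (begin-strict
  Q * w          ≤⟨ *-cancelʳ-≤ (Q * w) (L * n) (n ^ k) {{m^n≢0 n k {{n≢0}}}} Qwnᵏ≤Lnnᵏ ⟩
  L * n          ≡⟨ *-distribˡ-+ L w k ⟩
  L * w + L * k  <⟨ +-monoʳ-< (L * w) Lk<w ⟩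
  L * w + w      ≡⟨ +-comm (L * w) w ⟩
  suc L * w      ∎))
  where
  open ≤-Reasoning
  n = w + k
  n≢0 : NonZero n
  n≢0 = >-nonZero (≤-trans (m<n⇒0<n Lk<w) (m≤m+n w k))
  reorder : ∀ q w p → q * w * p ≡ q * p * w
  reorder = solve-∀
  Qwnᵏ≤Lnnᵏ : Q * w * n ^ k ≤ L * n * n ^ k
  Qwnᵏ≤Lnnᵏ = begin
    Q * w * n ^ k         ≡⟨ reorder Q w (n ^ k) ⟩
    Q * n ^ k * w         ≤⟨ *-monoˡ-≤ w hyp ⟩
    L * suc n ^ k * w     ≡⟨ *-assoc L (suc n ^ k) w ⟩
    L * (suc n ^ k * w)   ≤⟨ *-monoʳ-≤ L (bernoulli k w) ⟩
    L * (n * n ^ k)       ≡⟨ *-assoc L n (n ^ k) ⟨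
    L * n * n ^ k         ∎

-- The hypothesis is applied to the approximations (x_j N − 1)/N of x_j = ⌊log^j c⌋, N = Lk + k + 2.
floorPhi-bound : ∀ {c k M L} → (∀ (j : Fin k) → 1 ≤ iterLog (toℕ j) c) → PhiTimesLe c k M L →
  M * floorPhi k c ≤ L
floorPhi-bound {c} {k} {M} {L} pos φM≤L = pow-ratio-≤-cancel (n<1+n (L * k)) (begin
  M * floorPhi k c * n ^ k        ≡⟨ *-assoc M (floorPhi k c) (n ^ k) ⟩
  M * (floorPhi k c * n ^ k)      ≡⟨ cong (M *_) (prodF-*ʳ x n) ⟩
  M * prodF (λ j → x j * n)       ≤⟨ *-monoʳ-≤ M (prodF-mono-≤ (λ j → x*n≤x*[1+n]∸1 n (pos j))) ⟩
  M * prodF a                     ≤⟨ φM≤L a (λ _ → suc n) (λ j → z<s , below j) ⟩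
  L * prodF {k} (λ _ → suc n)     ≡⟨ cong (L *_) (prodF-const k (suc n)) ⟩
  L * suc n ^ k                   ∎)
  where
  open ≤-Reasoning
  n = suc (L * k) + k
  x : Fin k → ℕ
  x j = iterLog (toℕ j) c
  a : Fin k → ℕ
  a j = x j * suc n ∸ 1
  below : ∀ j → BelowLog c (toℕ j) (a j) (suc n)
  below j = floor-below-log c (toℕ j) (∸-monoʳ-< z<s (*-mono-≤ (pos j) z<s))

happy-periodic : ∀ c i → Happy c i → Happy c (i + 2 ^ length (ω c))
happy-periodic c i = trans (lowBits-periodic (length (ω c)) i)

theorem3 : (n : ℕ) (E : Fin n → Fin n → Set) (col : Fin n → ℕ) →
    (∀ p → 1 ≤ col p) →
    (∀ p q → E p q → col p ≢ col q) →
    (p : Fin n) (k : ℕ) → IsLogStar (col p) k →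
    (L : ℕ) → PhiTimesLe (col p) k (2 ^ (k + 1)) L →
    (s : ℕ) → 1 ≤ s →
    Σ ℕ λ i → (s ≤ i) × (i < s + L) × Happy (col p) i
theorem3 n E col _ _ p k logStar L φM≤L s _
  with lowBits-surjective (ω (col p))
... | r , r<period , happy-r
  with periodic-window (Happy (col p)) (happy-periodic (col p)) r<period happy-r s
... | i , s≤i , i<s+period , happy-i = i , s≤i , ≤-trans i<s+period (+-monoʳ-≤ s period≤L) , happy-i
  where
  period≤L : 2 ^ length (ω (col p)) ≤ L
  period≤L = ≤-trans (2^len-ω≤ logStar) (floorPhi-bound {M = 2 ^ (k + 1)} (logStar⇒1≤iterLog logStar) φM≤L)
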